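{- Let $G=(V,E)$ be a graph whose vertices are labeled by distinct elements of a totally ordered set, and let $w$ be a $123$-avoiding word representing $G$. Suppose $w$ has a factor (two consecutive letters) $ab$ with $a<b$, and let $w'$ be the word obtained from $w$ by swapping these two consecutive letters, so that this factor becomes $ba$. Then $w'$ is $123$-avoiding. Furthermore, if $ab\notin E$ and $a$ and $b$ do not alternate in $w'$, then $w'$ represents $G$.
   Context: A word is a finite sequence of letters from a totally ordered alphabet. Two letters $x,y$ alternate in a word $w$ if between any two occurrences of $x$ there is an occurrence of $y$ and between any two occurrences of $y$ there is an occurrence of $x$. A graph $G=(V,E)$ is represented by a word $w$ over $V$ if for all distinct $x,y\in V$, $x$ and $y$ alternate in $w$ if and only if $xy\in E$. A word is $123$-avoiding if it has no strictly increasing subsequence of length $3$. -}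

module Defs where

open import Level using (Level; _⊔_; suc)
open import Data.List using (List; length; lookup; _++_; _∷_)
open import Data.List.Membership.Propositional using (_∈_)
open import Data.Fin using (Fin)
import Data.Fin as Fin
open import Data.Product using (∃; _×_; _,_)
open import Relation.Binary using (Rel)
open import Relation.Binary.PropositionalEquality using (_≡_)
open import Relation.Nullary using (¬_)
open import Function.Bundles using (_⇔_)

Separates : ∀ {a} {A : Set a} → List A → A → A → Set a
Separates w x y =
  ∀ (i j : Fin (length w)) → i Fin.< j → lookup w i ≡ x → lookup w j ≡ x →
  ∃ λ (k : Fin (length w)) → (i Fin.< k) × (k Fin.< j) × (lookup w k ≡ y)

Alternate : ∀ {a} {A : Set a} → List A → A → A → Set a
Alternate w x y = Separates w x y × Separates w y x

Avoids123 : ∀ {a ℓ} {A : Set a} → Rel A ℓ → List A → Set ℓ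
Avoids123 _<_ w =
  ¬ (∃ λ (i : Fin (length w)) → ∃ λ (j : Fin (length w)) → ∃ λ (k : Fin (length w)) →
       (i Fin.< j) × (j Fin.< k) × (lookup w i < lookup w j) × (lookup w j < lookup w k))

record Graph {a} (A : Set a) (ℓ : Level) : Set (a ⊔ suc ℓ) where
  field
    V    : List A
    E    : Rel A ℓ
    sym  : ∀ {x y} → E x y → E y x
    irr  : ∀ {x} → ¬ E x x
    E⊆V  : ∀ {x y} → E x y → (x ∈ V) × (y ∈ V)

Represents : ∀ {a ℓ} {A : Set a} → Graph A ℓ → List A → Set (a ⊔ ℓ)
Represents G w =
  (∀ {z} → z ∈ w → z ∈ V) ×
  (∀ x y → x ∈ V → y ∈ V → ¬ x ≡ y → (Alternate w x y ⇔ E x y))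
  where open Graph G

module Submission where

-- Write w = u ++ x ∷ y ∷ v and w′ = u ++ y ∷ x ∷ v.  The positions of w′ are
-- matched with those of w by the transposition σ exchanging the two cells
-- of the factor; σ preserves letters, is its own inverse, and preserves the
-- order of positions except for the one pair of cells carrying y, x in w′.
-- From this single fact about σ we get two transfer principles:
--   * a strictly increasing subsequence of w′ maps to one of w, because the
--     only inverted pair reads  y, x  and y < x is impossible; hence w′
--     avoids 123 whenever w does;
--   * for letters p, q with {p, q} ≠ {x, y}, "q separates p" transfers from w
--     to w′ (the inverted pair never consists of an occurrence of p and one
--     of q), so p and q alternate in w iff they alternate in w′.
-- Since w′ is a permutation of w it has the same letters, and the pair x, y
-- itself is handled by the hypotheses (xy ∉ E, x and y do not alternate in w′).

open import Defs
open import Data.List using (List; _++_; _∷_; []; length; lookup)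
open import Data.List.Membership.Propositional using (_∈_)
open import Data.List.Relation.Binary.Permutation.Propositional using (↭-refl; ↭-swap)
open import Data.List.Relation.Binary.Permutation.Propositional.Properties using (∈-resp-↭; ++⁺ˡ)
open import Data.Product using (_×_; _,_)
open import Data.Sum using (_⊎_; inj₁; inj₂; [_,_])
open import Data.Empty using (⊥-elim)
open import Data.Fin using (Fin; zero; suc; _<_)
open import Data.Nat using (z≤n; s≤s)
open import Relation.Binary using (Rel; IsStrictTotalOrder)
open import Relation.Binary.PropositionalEquality using (_≡_; refl; sym; trans; subst; subst₂; cong)
open import Relation.Nullary using (¬_; yes; no)
open import Relation.Nullary.Decidable using (_×-dec_; _⊎-dec_)
open import Function.Bundles using (_⇔_; mk⇔)
open import Function.Construct.Symmetry using (⇔-sym)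
open import Function.Construct.Composition using (_⇔-∘_)

module _ {a} {A : Set a} where

  transpose : (u : List A) (x y : A) (v : List A) →
              Fin (length (u ++ y ∷ x ∷ v)) → Fin (length (u ++ x ∷ y ∷ v))
  transpose []      x y v zero          = suc zero
  transpose []      x y v (suc zero)    = zero
  transpose []      x y v (suc (suc i)) = suc (suc i)
  transpose (_ ∷ u) x y v zero          = zero
  transpose (_ ∷ u) x y v (suc i)       = suc (transpose u x y v i)

  lookup-transpose : ∀ u x y v i →
    lookup (u ++ y ∷ x ∷ v) i ≡ lookup (u ++ x ∷ y ∷ v) (transpose u x y v i)
  lookup-transpose []      x y v zero          = refl
  lookup-transpose []      x y v (suc zero)    = refl
  lookup-transpose []      x y v (suc (suc i)) = refl
  lookup-transpose (_ ∷ u) x y v zero          = refl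
  lookup-transpose (_ ∷ u) x y v (suc i)       = lookup-transpose u x y v i

  transpose-involutive : ∀ u x y v i → transpose u y x v (transpose u x y v i) ≡ i
  transpose-involutive []      x y v zero          = refl
  transpose-involutive []      x y v (suc zero)    = refl
  transpose-involutive []      x y v (suc (suc i)) = refl
  transpose-involutive (_ ∷ u) x y v zero          = refl
  transpose-involutive (_ ∷ u) x y v (suc i)       = cong suc (transpose-involutive u x y v i)

  transpose-monotone : ∀ u x y v (i j : Fin (length (u ++ y ∷ x ∷ v))) → i < j →
    transpose u x y v i < transpose u x y v j ⊎
    (lookup (u ++ y ∷ x ∷ v) i ≡ y × lookup (u ++ y ∷ x ∷ v) j ≡ x)
  transpose-monotone []      x y v zero          (suc zero)    _ = inj₂ (refl , refl)
  transpose-monotone []      x y v zero          (suc (suc j)) _ = inj₁ (s≤s (s≤s z≤n))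
  transpose-monotone []      x y v (suc zero)    (suc (suc j)) _ = inj₁ (s≤s z≤n)
  transpose-monotone []      x y v (suc zero)    (suc zero)    (s≤s ())
  transpose-monotone []      x y v (suc (suc i)) (suc zero)    (s≤s ())
  transpose-monotone []      x y v (suc (suc i)) (suc (suc j)) i<j = inj₁ i<j
  transpose-monotone (_ ∷ u) x y v zero          (suc j)       _ = inj₁ (s≤s z≤n)
  transpose-monotone (_ ∷ u) x y v (suc i)       (suc j)       (s≤s i<j) =
    [ (λ σi<σj → inj₁ (s≤s σi<σj)) , inj₂ ] (transpose-monotone u x y v i j i<j)

module Swap {a} {A : Set a} (u : List A) (x y : A) (v : List A) where

  w w′ : List A
  w  = u ++ x ∷ y ∷ v
  w′ = u ++ y ∷ x ∷ v

  σ : Fin (length w′) → Fin (length w)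
  σ = transpose u x y v

  σ⁻¹ : Fin (length w) → Fin (length w′)
  σ⁻¹ = transpose u y x v

  σ-< : ∀ {i j} → i < j → ¬ (lookup w′ i ≡ y × lookup w′ j ≡ x) → σ i < σ j
  σ-< {i} {j} i<j not-yx = [ (λ σi<σj → σi<σj) , (λ yx → ⊥-elim (not-yx yx)) ]
                             (transpose-monotone u x y v i j i<j)

  σ⁻¹-<ˡ : ∀ {i k} → σ i < k → ¬ (lookup w (σ i) ≡ x × lookup w k ≡ y) → i < σ⁻¹ k
  σ⁻¹-<ˡ {i} {k} σi<k not-xy =
    subst (_< σ⁻¹ k) (transpose-involutive u x y v i)
      ([ (λ r → r) , (λ xy → ⊥-elim (not-xy xy)) ] (transpose-monotone u y x v (σ i) k σi<k))

  σ⁻¹-<ʳ : ∀ {k j} → k < σ j → ¬ (lookup w k ≡ x × lookup w (σ j) ≡ y) → σ⁻¹ k < j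
  σ⁻¹-<ʳ {k} {j} k<σj not-xy =
    subst (σ⁻¹ k <_) (transpose-involutive u x y v j)
      ([ (λ r → r) , (λ xy → ⊥-elim (not-xy xy)) ] (transpose-monotone u y x v k (σ j) k<σj))

  lookup-σ : ∀ i → lookup w′ i ≡ lookup w (σ i)
  lookup-σ = lookup-transpose u x y v

  lookup-σ⁻¹ : ∀ k → lookup w′ (σ⁻¹ k) ≡ lookup w k
  lookup-σ⁻¹ k = trans (lookup-σ (σ⁻¹ k)) (cong (lookup w) (transpose-involutive u y x v k))

  -- A 123-pattern in w′ is carried by σ to a 123-pattern in w, as the only
  -- order-reversed pair of positions reads  y, x  and y < x fails.
  avoids123-swap : ∀ {ℓ} {_≺_ : Rel A ℓ} → ¬ (y ≺ x) → Avoids123 _≺_ w → Avoids123 _≺_ w′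
  avoids123-swap {_≺_ = _≺_} y⊀x avoid (i , j , k , i<j , j<k , wi≺wj , wj≺wk) =
    avoid (σ i , σ j , σ k , σ-< i<j (increasing wi≺wj) , σ-< j<k (increasing wj≺wk) ,
           subst₂ _≺_ (lookup-σ i) (lookup-σ j) wi≺wj ,
           subst₂ _≺_ (lookup-σ j) (lookup-σ k) wj≺wk)
    where
    increasing : ∀ {i j} → lookup w′ i ≺ lookup w′ j → ¬ (lookup w′ i ≡ y × lookup w′ j ≡ x)
    increasing wi≺wj (wi≡y , wj≡x) = y⊀x (subst₂ _≺_ wi≡y wj≡x wi≺wj)

  -- Separation of p by q transfers from w to w′, as long as the only
  -- order-changing pair of cells (x, y) is not an occurrence of p and one of q.
  separates-swap : ∀ {p q} → ¬ x ≡ y → ¬ (p ≡ x × q ≡ y) → ¬ (p ≡ y × q ≡ x) →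
                   Separates w p q → Separates w′ p q
  separates-swap {p} {q} x≢y not-pxqy not-pyqx sep i j i<j wi≡p wj≡p
    with sep (σ i) (σ j) (σ-< i<j not-yx) (trans (sym (lookup-σ i)) wi≡p)
                                          (trans (sym (lookup-σ j)) wj≡p)
    where
    not-yx : ¬ (lookup w′ i ≡ y × lookup w′ j ≡ x)
    not-yx (wi≡y , wj≡x) = x≢y (trans (sym wj≡x) (trans wj≡p (trans (sym wi≡p) wi≡y)))
  ... | k , σi<k , k<σj , wk≡q =
    σ⁻¹ k ,
    σ⁻¹-<ˡ σi<k (λ (x′ , y′) → not-pxqy (trans (sym (trans (sym (lookup-σ i)) wi≡p)) x′ ,
                                          trans (sym wk≡q) y′)) ,
    σ⁻¹-<ʳ k<σj (λ (x′ , y′) → not-pyqx (trans (sym (trans (sym (lookup-σ j)) wj≡p)) y′ ,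
                                          trans (sym wk≡q) x′)) ,
    trans (lookup-σ⁻¹ k) wk≡q

module _ {a} {A : Set a} where

  SamePair : A → A → A → A → Set a
  SamePair p q x y = (p ≡ x × q ≡ y) ⊎ (p ≡ y × q ≡ x)

  alternate-swap : ∀ u v {x y p q : A} → ¬ x ≡ y → ¬ SamePair p q x y →
                   Alternate (u ++ x ∷ y ∷ v) p q ⇔ Alternate (u ++ y ∷ x ∷ v) p q
  alternate-swap u v {x} {y} x≢y not-same = mk⇔
    (λ (sep-pq , sep-qp) →
       Swap.separates-swap u x y v x≢y (λ e → not-same (inj₁ e)) (λ e → not-same (inj₂ e)) sep-pq ,
       Swap.separates-swap u x y v x≢y (λ (e , f) → not-same (inj₂ (f , e)))
                                       (λ (e , f) → not-same (inj₁ (f , e))) sep-qp)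
    (λ (sep-pq , sep-qp) →
       Swap.separates-swap u y x v y≢x (λ e → not-same (inj₂ e)) (λ e → not-same (inj₁ e)) sep-pq ,
       Swap.separates-swap u y x v y≢x (λ (e , f) → not-same (inj₁ (f , e)))
                                       (λ (e , f) → not-same (inj₂ (f , e))) sep-qp)
    where
    y≢x : ¬ y ≡ x
    y≢x e = x≢y (sym e)

  ∈-swap : ∀ u v {x y z : A} → z ∈ u ++ y ∷ x ∷ v → z ∈ u ++ x ∷ y ∷ v
  ∈-swap u v {x} {y} = ∈-resp-↭ (++⁺ˡ u (↭-swap y x ↭-refl))

lemma3p3 : ∀ {a ℓ ℓ′} {A : Set a} {_<_ : Rel A ℓ} → IsStrictTotalOrder _≡_ _<_ →
    (G : Graph A ℓ′) (u v : List A) (x y : A) →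
    Represents G (u ++ x ∷ y ∷ v) → Avoids123 _<_ (u ++ x ∷ y ∷ v) → x < y →
    Avoids123 _<_ (u ++ y ∷ x ∷ v) ×
    (¬ Graph.E G x y → ¬ Alternate (u ++ y ∷ x ∷ v) x y → Represents G (u ++ y ∷ x ∷ v))
lemma3p3 {_<_ = _<_} sto G u v x y (letters , alternation) avoid x<y =
  Swap.avoids123-swap u x y v {_≺_ = _<_} (asym x<y) avoid ,
  λ not-xy not-alt → (λ z∈w′ → letters (∈-swap u v z∈w′)) , alternation′ not-xy not-alt
  where
  open IsStrictTotalOrder sto using (asym; irrefl; _≟_)
  open Graph G using (E) renaming (sym to E-sym)

  x≢y : ¬ x ≡ y
  x≢y x≡y = irrefl x≡y x<y

  alternation′ : ¬ E x y → ¬ Alternate (u ++ y ∷ x ∷ v) x y →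
                 ∀ p q → p ∈ Graph.V G → q ∈ Graph.V G → ¬ p ≡ q →
                 Alternate (u ++ y ∷ x ∷ v) p q ⇔ E p q
  alternation′ not-xy not-alt p q p∈V q∈V p≢q
    with ((p ≟ x) ×-dec (q ≟ y)) ⊎-dec ((p ≟ y) ×-dec (q ≟ x))
  -- The pair {x, y} itself: neither alternating nor adjacent.
  ... | yes (inj₁ (refl , refl)) = mk⇔ (λ alt → ⊥-elim (not-alt alt)) (λ e → ⊥-elim (not-xy e))
  ... | yes (inj₂ (refl , refl)) =
    mk⇔ (λ (s , t) → ⊥-elim (not-alt (t , s))) (λ e → ⊥-elim (not-xy (E-sym e)))
  -- Every other pair alternates in w′ iff it alternates in w iff it is an edge.
  ... | no not-same =
    alternation p q p∈V q∈V p≢q ⇔-∘ ⇔-sym (alternate-swap u v x≢y not-same)
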